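{- Let $K_{m,n}$ be the complete bipartite graph with bipartition $(X,Y)$, $|X|=m>1$, $|Y|=n>1$, and $V=X\cup Y$. Then the center sets of $K_{m,n}$ are exactly: $V$; $X$; $Y$; the singletons $\{v\}$, $v\in V$; and the pairs $\{x,y\}$ with $x\in X$, $y\in Y$.
   Context: $d$ is shortest-path distance. For nonempty $S\subseteq V$, $e_S(v)=\max_{x\in S}d(v,x)$ and $C_S(G)=\{v\in V: e_S(v)\le e_S(x)\ \forall x\in V\}$. A set $A\subseteq V$ is a center set of $G$ if $A=C_S(G)$ for some nonempty $S\subseteq V$. -}

module Defs where

open import Level using (0ℓ)
open import Data.Nat using (ℕ; zero; suc; _≤_)
open import Data.Fin using (Fin)
open import Data.Sum using (_⊎_; inj₁; inj₂)
open import Data.Product using (Σ; ∃; ∃-syntax; _×_; _,_)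
open import Data.Unit using (⊤)
open import Data.Empty using (⊥)
open import Data.Bool using (Bool; true)
open import Relation.Binary.PropositionalEquality using (_≡_)
open import Function.Bundles using (_⇔_)

record Graph : Set₁ where
  field
    V   : Set
    Adj : V → V → Set

module _ (G : Graph) where
  open Graph G

  data Walk : V → V → ℕ → Set where
    here : ∀ {u} → Walk u u zero
    step : ∀ {u w v k} → Adj u w → Walk w v k → Walk u v (suc k)

  IsDist : V → V → ℕ → Set
  IsDist u v k = Walk u v k × (∀ j → Walk u v j → k ≤ j)

  VSet : Set
  VSet = V → Bool

  _∈_ : V → VSet → Set
  v ∈ S = S v ≡ true

  IsEcc : VSet → V → ℕ → Set
  IsEcc S v e =
    (∃[ x ] (x ∈ S × IsDist v x e)) ×
    (∀ x k → x ∈ S → IsDist v x k → k ≤ e)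

  InCenter : VSet → V → Set
  InCenter S v = ∀ x ev ex → IsEcc S v ev → IsEcc S x ex → ev ≤ ex

  IsCenterSet : VSet → Set
  IsCenterSet A =
    ∃[ S ] ((∃[ s ] s ∈ S) × (∀ v → (v ∈ A) ⇔ InCenter S v))

-- complete bipartite graph K_{m,n}, vertex set X ⊎ Y with X = Fin m, Y = Fin n
KAdj : (m n : ℕ) → Fin m ⊎ Fin n → Fin m ⊎ Fin n → Set
KAdj m n (inj₁ _) (inj₁ _) = ⊥
KAdj m n (inj₁ _) (inj₂ _) = ⊤
KAdj m n (inj₂ _) (inj₁ _) = ⊤
KAdj m n (inj₂ _) (inj₂ _) = ⊥

K : ℕ → ℕ → Graph
K m n = record { V = Fin m ⊎ Fin n ; Adj = KAdj m n }

_≐_ : {V : Set} → (V → Bool) → (V → Set) → Set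
A ≐ P = ∀ v → (A v ≡ true) ⇔ P v

inX : {m n : ℕ} → Fin m ⊎ Fin n → Set
inX (inj₁ _) = ⊤
inX (inj₂ _) = ⊥

inY : {m n : ℕ} → Fin m ⊎ Fin n → Set
inY (inj₁ _) = ⊥
inY (inj₂ _) = ⊤

allV : {m n : ℕ} → Fin m ⊎ Fin n → Set
allV _ = ⊤

-- In K_{m,n} distinct vertices are at distance 1 on different sides and 2 on the same side, so all
-- eccentricities are 0, 1 or 2. A vertex v is central for S iff, for every radius r, v has all of S
-- within distance r as soon as some vertex does. Radius 0 is achieved only when S = {s}, and v has S
-- within radius 1 iff S meets the side of v in at most v. So the center is {s} if S = {s}, otherwise
-- the radius-1 set if it is nonempty, otherwise V; counting the points of S on each side (none, one,
-- several) identifies the radius-1 set as X, Y, a vertex, or an edge.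
module Submission where

open import Defs
open import Data.Nat using (ℕ; zero; suc; _+_; _<_; _≤_; z≤n; s≤s; s≤s⁻¹; _≟_)
open import Data.Nat.Properties using (≤-antisym; ≤-refl; ≤-reflexive; ≤-trans; n≤0⇒n≡0; ≤∧≢⇒<)
open import Data.Fin using (Fin) renaming (zero to fzero; suc to fsuc)
import Data.Fin.Properties as Fin
open import Data.Sum using (_⊎_; inj₁; inj₂; [_,_]′)
open import Data.Sum.Properties using (inj₁-injective; inj₂-injective; ≡-dec)
open import Data.Product using (∃; ∃-syntax; _×_; _,_; proj₁; proj₂)
open import Data.Bool using (Bool; true; false)
import Data.Bool.Properties as Bool
open import Data.Unit using (⊤; tt)
open import Data.Empty using (⊥-elim)
open import Function using (_∘_; const)
open import Relation.Nullary using (¬_; Dec; yes; no; does; contradiction)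
open import Relation.Nullary.Decidable using (_×-dec_; ¬?; dec-true; decidable-stable)
open import Relation.Unary using (Decidable)
open import Relation.Binary.Definitions using (DecidableEquality)
open import Relation.Binary.PropositionalEquality using (_≡_; _≢_; refl; sym; cong; subst)
open import Function.Bundles using (_⇔_; mk⇔; Equivalence)
import Function.Properties.Equivalence as ⇔

open Equivalence using (to; from)

_≈_ : {A : Set} → (A → Set) → (A → Set) → Set
P ≈ Q = ∀ a → P a ⇔ Q a

⇔-both : {A B : Set} → A → B → A ⇔ B
⇔-both a b = mk⇔ (const b) (const a)

⇔-neither : {A B : Set} → ¬ A → ¬ B → A ⇔ B
⇔-neither ¬a ¬b = mk⇔ (⊥-elim ∘ ¬a) (⊥-elim ∘ ¬b)

Searchable : Set → Set₁
Searchable A = ∀ {P : A → Set} → Decidable P → Dec (∃ P)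

⊎-searchable : {A B : Set} → Searchable A → Searchable B → Searchable (A ⊎ B)
⊎-searchable any₁? any₂? P? with any₁? (P? ∘ inj₁) | any₂? (P? ∘ inj₂)
... | yes (a , pa) | _            = yes (inj₁ a , pa)
... | no _         | yes (b , pb) = yes (inj₂ b , pb)
... | no ∄a        | no ∄b        = no λ { (inj₁ a , pa) → ∄a (a , pa) ; (inj₂ b , pb) → ∄b (b , pb) }

max-attained : {A : Set} → Searchable A → {P : A → Set} → Decidable P → (f : A → ℕ) →
               ∃ P → (B : ℕ) → (∀ x → P x → f x ≤ B) →
               ∃[ e ] (∃[ x ] (P x × f x ≡ e)) × (∀ x → P x → f x ≤ e)
max-attained any? P? f (x , px) zero bound = 0 , (x , px , n≤0⇒n≡0 (bound x px)) , bound
max-attained any? P? f p (suc B) bound with any? (λ x → P? x ×-dec (f x ≟ suc B))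
... | yes attained = suc B , attained , bound
... | no ∄x = max-attained any? P? f p B
                (λ x px → s≤s⁻¹ (≤∧≢⇒< (bound x px) (λ fx≡ → ∄x (x , px , fx≡))))

Lone : {A : Set} → (A → Bool) → A → Set
Lone P a = ∀ b → P b ≡ true → b ≡ a

Empty : {A : Set} → (A → Bool) → Set
Empty P = ∀ a → P a ≢ true

Single : {A : Set} → (A → Bool) → A → Set
Single P a = P a ≡ true × Lone P a

Many : {A : Set} → (A → Bool) → Set
Many P = ∃[ a ] ∃[ b ] (a ≢ b × P a ≡ true × P b ≡ true)

data Occupancy {A : Set} (P : A → Bool) : Set where
  empty  : Empty P → Occupancy P
  single : ∀ a → Single P a → Occupancy P
  many   : Many P → Occupancy P

occupancy : {A : Set} → Searchable A → DecidableEquality A → (P : A → Bool) → Occupancy P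
occupancy any? _≟ᴬ_ P with any? (λ a → P a Bool.≟ true)
... | no ∄a = empty (λ a pa → ∄a (a , pa))
... | yes (a , pa) with any? (λ b → (P b Bool.≟ true) ×-dec ¬? (b ≟ᴬ a))
...   | yes (b , pb , b≢a) = many (a , b , b≢a ∘ sym , pa , pb)
...   | no ∄b = single a (pa , λ b pb → decidable-stable (b ≟ᴬ a) (λ b≢a → ∄b (b , pb , b≢a)))

lone-empty : {A : Set} {P : A → Bool} → Empty P → ∀ a → Lone P a
lone-empty ∄ a b pb = contradiction pb (∄ b)

lone-single : {A : Set} {P : A → Bool} {a₀ : A} → Single P a₀ → ∀ a → Lone P a ⇔ a ≡ a₀
lone-single (pa₀ , lone₀) a = mk⇔ (λ lone → sym (lone _ pa₀)) (λ { refl → lone₀ })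

singleton : {A : Set} → DecidableEquality A → A → A → Bool
singleton _≟ᴬ_ a b = does (b ≟ᴬ a)

single-singleton : {A : Set} (_≟ᴬ_ : DecidableEquality A) → ∀ a → Single (singleton _≟ᴬ_ a) a
single-singleton _≟ᴬ_ a = dec-true (a ≟ᴬ a) refl , lone
  where
  lone : Lone (singleton _≟ᴬ_ a) a
  lone b b∈ with b ≟ᴬ a
  ... | yes b≡a = b≡a
  ... | no _    = contradiction b∈ λ ()

¬lone-many : {A : Set} {P : A → Bool} → Many P → ∀ c → ¬ Lone P c
¬lone-many (a , b , a≢b , pa , pb) c lone with lone a pa | lone b pb
... | refl | refl = a≢b refl

isDist-unique : ∀ {G u v k l} → IsDist G u v k → IsDist G u v l → k ≡ l
isDist-unique (walk , minimal) (walk′ , minimal′) = ≤-antisym (minimal _ walk′) (minimal′ _ walk)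

module Metric (G : Graph) (d : Graph.V G → Graph.V G → ℕ)
              (d-isDist : ∀ u v → IsDist G u v (d u v)) where
  open Graph G

  d-self : ∀ v → d v v ≡ 0
  d-self v = n≤0⇒n≡0 (proj₂ (d-isDist v v) 0 here)

  d≡0⇒≡ : ∀ {u v} → d u v ≡ 0 → u ≡ v
  d≡0⇒≡ {u} {v} d≡0 with subst (Walk G u v) d≡0 (proj₁ (d-isDist u v))
  ... | here = refl

  Covers : ℕ → VSet G → V → Set
  Covers k S v = ∀ x → S x ≡ true → d v x ≤ k

  covers⇔ecc≤ : ∀ {S v e k} → IsEcc G S v e → Covers k S v ⇔ e ≤ k
  covers⇔ecc≤ {v = v} ((x , sx , dist-e) , bound) = mk⇔
    (λ cover → subst (_≤ _) (isDist-unique (d-isDist v x) dist-e) (cover x sx))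
    (λ e≤k y sy → ≤-trans (bound y (d v y) sy (d-isDist v y)) e≤k)

  eccentricity : Searchable V → ∀ {S B s} → S s ≡ true → (∀ u v → d u v ≤ B) →
                 ∀ v → ∃ (IsEcc G S v)
  eccentricity any? {S} {B} {s} s∈S d≤B v
    with max-attained any? (λ x → S x Bool.≟ true) (d v) (s , s∈S) B (λ x _ → d≤B v x)
  ... | e , (x , sx , dx≡e) , bound =
    e , (x , sx , subst (IsDist G v x) dx≡e (d-isDist v x)) ,
    λ y k sy dist-k → subst (_≤ e) (isDist-unique (d-isDist v y) dist-k) (bound y sy)

  inCenter⇔covers : ∀ {S} → (∀ v → ∃ (IsEcc G S v)) →
                    ∀ v → InCenter G S v ⇔ (∀ k w → Covers k S w → Covers k S v)
  inCenter⇔covers ecc v = mk⇔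
    (λ central k w cover → let (ev , ecc-v) = ecc v; (ew , ecc-w) = ecc w in
      from (covers⇔ecc≤ ecc-v)
           (≤-trans (central w ev ew ecc-v ecc-w) (to (covers⇔ecc≤ ecc-w) cover)))
    (λ covering x ev ex ecc-v ecc-x →
      to (covers⇔ecc≤ ecc-v) (covering ex x (from (covers⇔ecc≤ ecc-x) ≤-refl)))

  lone⇒covers : ∀ {S v} k → Lone S v → Covers k S v
  lone⇒covers {v = v} k lone x sx =
    subst (λ y → d v y ≤ k) (sym (lone x sx)) (subst (_≤ k) (sym (d-self v)) z≤n)

  covers0⇔lone : ∀ {S} v → Covers 0 S v ⇔ Lone S v
  covers0⇔lone v = mk⇔ (λ cover x sx → sym (d≡0⇒≡ (n≤0⇒n≡0 (cover x sx)))) (lone⇒covers 0)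

module DiameterTwo (G : Graph) (d : Graph.V G → Graph.V G → ℕ)
                   (d-isDist : ∀ u v → IsDist G u v (d u v)) (d≤2 : ∀ u v → d u v ≤ 2)
                   (search : Searchable (Graph.V G)) where
  open Metric G d d-isDist public

  private
    inCenter⇔covering : ∀ {S s} → S s ≡ true →
                        ∀ v → InCenter G S v ⇔ (∀ k w → Covers k S w → Covers k S v)
    inCenter⇔covering s∈S = inCenter⇔covers (eccentricity search s∈S d≤2)

    covers-diameter : ∀ {S} k v → Covers (2 + k) S v
    covers-diameter k v x _ = ≤-trans (d≤2 v x) (s≤s (s≤s z≤n))

  center-lone : ∀ {S s} → S s ≡ true → Lone S s → InCenter G S ≈ (_≡ s)
  center-lone {s = s} s∈S lone v = ⇔.trans (inCenter⇔covering s∈S v) (mk⇔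
    (λ covering → sym (to (covers0⇔lone v) (covering 0 s (from (covers0⇔lone s) lone)) s s∈S))
    (λ { refl k _ _ → lone⇒covers k lone }))

  center-near : ∀ {S w} → Many S → Covers 1 S w → InCenter G S ≈ Covers 1 S
  center-near {w = w} S-many@(s , _ , _ , s∈S , _) cover₁ v = ⇔.trans (inCenter⇔covering s∈S v) (mk⇔
    (λ covering → covering 1 w cover₁)
    λ { cover-v zero u cover₀ → contradiction (to (covers0⇔lone u) cover₀) (¬lone-many S-many u)
      ; cover-v (suc k) _ _ x sx → ≤-trans (cover-v x sx) (s≤s z≤n) })

  center-all : ∀ {S} → Many S → (∀ w → ¬ Covers 1 S w) → InCenter G S ≈ (λ _ → ⊤)
  center-all S-many@(s , _ , _ , s∈S , _) ∄cover₁ v = ⇔.trans (inCenter⇔covering s∈S v) (⇔-both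
    (λ { zero u cover₀ → contradiction (to (covers0⇔lone u) cover₀) (¬lone-many S-many u)
       ; (suc zero) u cover₁ → contradiction cover₁ (∄cover₁ u)
       ; (suc (suc k)) _ _ → covers-diameter k v })
    tt)

sideDist : ∀ {k} → Fin k → Fin k → ℕ
sideDist a b with a Fin.≟ b
... | yes _ = 0
... | no _  = 2

sideDist-self : ∀ {k} (a : Fin k) → sideDist a a ≡ 0
sideDist-self a with a Fin.≟ a
... | yes _ = refl
... | no a≢a = contradiction refl a≢a

sideDist≤2 : ∀ {k} (a b : Fin k) → sideDist a b ≤ 2
sideDist≤2 a b with a Fin.≟ b
... | yes _ = z≤n
... | no _  = ≤-refl

sideDist≤1⇔≡ : ∀ {k} {a b : Fin k} → sideDist a b ≤ 1 ⇔ a ≡ b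
sideDist≤1⇔≡ {a = a} {b} with a Fin.≟ b
... | yes a≡b = ⇔-both z≤n a≡b
... | no a≢b  = ⇔-neither (λ { (s≤s ()) }) a≢b

module CompleteBipartite (m n : ℕ) where

  G : Graph
  G = K (suc m) (suc n)

  V : Set
  V = Fin (suc m) ⊎ Fin (suc n)

  dist : V → V → ℕ
  dist (inj₁ a) (inj₁ b) = sideDist a b
  dist (inj₁ _) (inj₂ _) = 1
  dist (inj₂ _) (inj₁ _) = 1
  dist (inj₂ a) (inj₂ b) = sideDist a b

  dist≤2 : ∀ u v → dist u v ≤ 2
  dist≤2 (inj₁ a) (inj₁ b) = sideDist≤2 a b
  dist≤2 (inj₁ _) (inj₂ _) = s≤s z≤n
  dist≤2 (inj₂ _) (inj₁ _) = s≤s z≤n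
  dist≤2 (inj₂ a) (inj₂ b) = sideDist≤2 a b

  dist-walk : ∀ u v → Walk G u v (dist u v)
  dist-walk (inj₁ a) (inj₁ b) with a Fin.≟ b
  ... | yes refl = here
  ... | no _     = step {w = inj₂ fzero} tt (step tt here)
  dist-walk (inj₁ _) (inj₂ _) = step tt here
  dist-walk (inj₂ _) (inj₁ _) = step tt here
  dist-walk (inj₂ a) (inj₂ b) with a Fin.≟ b
  ... | yes refl = here
  ... | no _     = step {w = inj₁ fzero} tt (step tt here)

  dist-minimal : ∀ {u v j} → Walk G u v j → dist u v ≤ j
  dist-minimal {inj₁ a} here = ≤-reflexive (sideDist-self a)
  dist-minimal {inj₂ b} here = ≤-reflexive (sideDist-self b)
  dist-minimal {inj₁ _} {inj₁ _} (step () here)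
  dist-minimal {inj₁ _} {inj₂ _} (step _ here) = ≤-refl
  dist-minimal {inj₂ _} {inj₁ _} (step _ here) = ≤-refl
  dist-minimal {inj₂ _} {inj₂ _} (step () here)
  dist-minimal {u} {v} (step _ (step _ _)) = ≤-trans (dist≤2 u v) (s≤s (s≤s z≤n))

  dist-isDist : ∀ u v → IsDist G u v (dist u v)
  dist-isDist u v = dist-walk u v , λ _ → dist-minimal

  open DiameterTwo G dist dist-isDist dist≤2 (⊎-searchable Fin.any? Fin.any?)

  near₁ : ∀ {S} a → Covers 1 S (inj₁ a) ⇔ Lone (S ∘ inj₁) a
  near₁ a = mk⇔ (λ cover b b∈ → sym (to sideDist≤1⇔≡ (cover (inj₁ b) b∈)))
    λ { lone (inj₁ b) b∈ → from sideDist≤1⇔≡ (sym (lone b b∈)) ; lone (inj₂ _) _ → ≤-refl }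

  near₂ : ∀ {S} b → Covers 1 S (inj₂ b) ⇔ Lone (S ∘ inj₂) b
  near₂ b = mk⇔ (λ cover a a∈ → sym (to sideDist≤1⇔≡ (cover (inj₂ a) a∈)))
    λ { lone (inj₂ a) a∈ → from sideDist≤1⇔≡ (sym (lone a a∈)) ; lone (inj₁ _) _ → ≤-refl }

  many-inj₁ : ∀ {S : V → Bool} → Many (S ∘ inj₁) → Many S
  many-inj₁ (a , b , a≢b , a∈ , b∈) = inj₁ a , inj₁ b , a≢b ∘ inj₁-injective , a∈ , b∈

  many-inj₂ : ∀ {S : V → Bool} → Many (S ∘ inj₂) → Many S
  many-inj₂ (a , b , a≢b , a∈ , b∈) = inj₂ a , inj₂ b , a≢b ∘ inj₂-injective , a∈ , b∈

  empty-⊎ : ∀ {S : V → Bool} → Empty (S ∘ inj₁) → Empty (S ∘ inj₂) → Empty S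
  empty-⊎ ∄₁ ∄₂ (inj₁ a) = ∄₁ a
  empty-⊎ ∄₁ ∄₂ (inj₂ b) = ∄₂ b

  lone-inj₁ : ∀ {S : V → Bool} {x} → Lone (S ∘ inj₁) x → Empty (S ∘ inj₂) → Lone S (inj₁ x)
  lone-inj₁ lone ∄₂ (inj₁ a) a∈ = cong inj₁ (lone a a∈)
  lone-inj₁ lone ∄₂ (inj₂ b) b∈ = contradiction b∈ (∄₂ b)

  lone-inj₂ : ∀ {S : V → Bool} {y} → Empty (S ∘ inj₁) → Lone (S ∘ inj₂) y → Lone S (inj₂ y)
  lone-inj₂ ∄₁ lone (inj₁ a) a∈ = contradiction a∈ (∄₁ a)
  lone-inj₂ ∄₁ lone (inj₂ b) b∈ = cong inj₂ (lone b b∈)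

  center-by-sides : ∀ {S : V → Bool} {P : V → Set} → Many S →
                    (∀ a → Lone (S ∘ inj₁) a ⇔ P (inj₁ a)) → (∀ b → Lone (S ∘ inj₂) b ⇔ P (inj₂ b)) →
                    ∃ P → InCenter G S ≈ P
  center-by-sides {S} {P} S-many side₁ side₂ (w , pw) v =
    ⇔.trans (center-near {S} {w} S-many (from (near w) pw) v) (near v)
    where
    near : ∀ v → Covers 1 S v ⇔ P v
    near (inj₁ a) = ⇔.trans (near₁ a) (side₁ a)
    near (inj₂ b) = ⇔.trans (near₂ b) (side₂ b)

  center-inX : ∀ {S : V → Bool} → Empty (S ∘ inj₁) → Many (S ∘ inj₂) → InCenter G S ≈ inX
  center-inX ∄₁ many₂ = center-by-sides (many-inj₂ many₂)
    (λ a → ⇔-both (lone-empty ∄₁ a) tt) (λ b → ⇔-neither (¬lone-many many₂ b) λ ()) (inj₁ fzero , tt)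

  center-inY : ∀ {S : V → Bool} → Many (S ∘ inj₁) → Empty (S ∘ inj₂) → InCenter G S ≈ inY
  center-inY many₁ ∄₂ = center-by-sides (many-inj₁ many₁)
    (λ a → ⇔-neither (¬lone-many many₁ a) λ ()) (λ b → ⇔-both (lone-empty ∄₂ b) tt) (inj₂ fzero , tt)

  center-inj₁ : ∀ {S : V → Bool} {x} → Single (S ∘ inj₁) x → Many (S ∘ inj₂) →
                InCenter G S ≈ (_≡ inj₁ x)
  center-inj₁ single₁ many₂ = center-by-sides (many-inj₂ many₂)
    (λ a → ⇔.trans (lone-single single₁ a) (mk⇔ (cong inj₁) inj₁-injective))
    (λ b → ⇔-neither (¬lone-many many₂ b) λ ()) (_ , refl)

  center-inj₂ : ∀ {S : V → Bool} {y} → Many (S ∘ inj₁) → Single (S ∘ inj₂) y →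
                InCenter G S ≈ (_≡ inj₂ y)
  center-inj₂ many₁ single₂ = center-by-sides (many-inj₁ many₁)
    (λ a → ⇔-neither (¬lone-many many₁ a) λ ())
    (λ b → ⇔.trans (lone-single single₂ b) (mk⇔ (cong inj₂) inj₂-injective)) (_ , refl)

  center-pair : ∀ {S : V → Bool} {x y} → Single (S ∘ inj₁) x → Single (S ∘ inj₂) y →
                InCenter G S ≈ (λ w → (w ≡ inj₁ x) ⊎ (w ≡ inj₂ y))
  center-pair single₁@(x∈ , _) single₂@(y∈ , _) = center-by-sides (_ , _ , (λ ()) , x∈ , y∈)
    (λ a → ⇔.trans (lone-single single₁ a) (mk⇔ (inj₁ ∘ cong inj₁) [ inj₁-injective , (λ ()) ]′))
    (λ b → ⇔.trans (lone-single single₂ b) (mk⇔ (inj₂ ∘ cong inj₂) [ (λ ()) , inj₂-injective ]′))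
    (_ , inj₁ refl)

  center-V : ∀ {S : V → Bool} → Many (S ∘ inj₁) → Many (S ∘ inj₂) → InCenter G S ≈ allV
  center-V many₁ many₂ = center-all (many-inj₁ many₁) λ
    { (inj₁ a) → ¬lone-many many₁ a ∘ to (near₁ a)
    ; (inj₂ b) → ¬lone-many many₂ b ∘ to (near₂ b) }

  Listed : ((V → Set) → Set) → Set
  Listed F = F allV ⊎ F inX ⊎ F inY ⊎ (∃[ v ] F (λ w → w ≡ v))
           ⊎ (∃[ x ] ∃[ y ] F (λ w → (w ≡ inj₁ x) ⊎ (w ≡ inj₂ y)))

  mapListed : ∀ {F H : (V → Set) → Set} → (∀ {P} → F P → H P) → Listed F → Listed H
  mapListed f (inj₁ p)                                = inj₁ (f p)
  mapListed f (inj₂ (inj₁ p))                         = inj₂ (inj₁ (f p))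
  mapListed f (inj₂ (inj₂ (inj₁ p)))                  = inj₂ (inj₂ (inj₁ (f p)))
  mapListed f (inj₂ (inj₂ (inj₂ (inj₁ (v , p)))))     = inj₂ (inj₂ (inj₂ (inj₁ (v , f p))))
  mapListed f (inj₂ (inj₂ (inj₂ (inj₂ (x , y , p))))) = inj₂ (inj₂ (inj₂ (inj₂ (x , y , f p))))

  center-listed : ∀ {S : V → Bool} {s} → S s ≡ true → Listed (InCenter G S ≈_)
  center-listed {S} {s} s∈S
    with occupancy Fin.any? Fin._≟_ (S ∘ inj₁) | occupancy Fin.any? Fin._≟_ (S ∘ inj₂)
  ... | empty ∄₁              | empty ∄₂              = contradiction s∈S (empty-⊎ {S} ∄₁ ∄₂ s)
  ... | empty ∄₁              | single y (y∈ , lone₂) =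
    inj₂ (inj₂ (inj₂ (inj₁ (_ , center-lone {S} y∈ (lone-inj₂ ∄₁ lone₂)))))
  ... | empty ∄₁              | many many₂            = inj₂ (inj₁ (center-inX ∄₁ many₂))
  ... | single x (x∈ , lone₁) | empty ∄₂              =
    inj₂ (inj₂ (inj₂ (inj₁ (_ , center-lone {S} x∈ (lone-inj₁ lone₁ ∄₂)))))
  ... | single x single₁      | single y single₂      =
    inj₂ (inj₂ (inj₂ (inj₂ (x , y , center-pair single₁ single₂))))
  ... | single x single₁      | many many₂            =
    inj₂ (inj₂ (inj₂ (inj₁ (_ , center-inj₁ single₁ many₂))))
  ... | many many₁            | empty ∄₂              = inj₂ (inj₂ (inj₁ (center-inY many₁ ∄₂)))
  ... | many many₁            | single y single₂      =
    inj₂ (inj₂ (inj₂ (inj₁ (_ , center-inj₂ many₁ single₂))))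
  ... | many many₁            | many many₂            = inj₁ (center-V many₁ many₂)

  Realizable : (V → Set) → Set
  Realizable P = ∃[ S ] (∃[ s ] S s ≡ true) × (InCenter G S ≈ P)

  realize-V : ∀ {x₁ x₂ y₁ y₂} → x₁ ≢ x₂ → y₁ ≢ y₂ → Realizable allV
  realize-V {x₁} x₁≢x₂ y₁≢y₂ =
    const true , (inj₁ x₁ , refl) , center-V (_ , _ , x₁≢x₂ , refl , refl) (_ , _ , y₁≢y₂ , refl , refl)

  realize-inX : ∀ {y₁ y₂} → y₁ ≢ y₂ → Realizable inX
  realize-inX {y₁} y₁≢y₂ =
    [ const false , const true ]′ , (inj₂ y₁ , refl) , center-inX (λ _ ()) (_ , _ , y₁≢y₂ , refl , refl)

  realize-inY : ∀ {x₁ x₂} → x₁ ≢ x₂ → Realizable inY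
  realize-inY {x₁} x₁≢x₂ =
    [ const true , const false ]′ , (inj₁ x₁ , refl) , center-inY (_ , _ , x₁≢x₂ , refl , refl) (λ _ ())

  realize-point : ∀ v → Realizable (_≡ v)
  realize-point v =
    singleton _≟ⱽ_ v , (v , proj₁ single-v) , center-lone (proj₁ single-v) (proj₂ single-v)
    where
    _≟ⱽ_ : DecidableEquality V
    _≟ⱽ_ = ≡-dec Fin._≟_ Fin._≟_
    single-v : Single (singleton _≟ⱽ_ v) v
    single-v = single-singleton _≟ⱽ_ v

  realize-pair : ∀ x y → Realizable (λ w → (w ≡ inj₁ x) ⊎ (w ≡ inj₂ y))
  realize-pair x y = [ singleton Fin._≟_ x , singleton Fin._≟_ y ]′ , (inj₁ x , proj₁ single₁) ,
                     center-pair single₁ (single-singleton Fin._≟_ y)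
    where
    single₁ : Single (singleton Fin._≟_ x) x
    single₁ = single-singleton Fin._≟_ x

  isCenterSet⇒listed : ∀ {A} → IsCenterSet G A → Listed (A ≐_)
  isCenterSet⇒listed (S , (s , s∈S) , A≐center) =
    mapListed {InCenter G S ≈_} (λ center≈P v → ⇔.trans (A≐center v) (center≈P v))
              (center-listed {S} s∈S)

  realizable⇒isCenterSet : ∀ {A P} → A ≐ P → Realizable P → IsCenterSet G A
  realizable⇒isCenterSet A≐P (S , nonempty , center≈P) =
    S , nonempty , λ v → ⇔.trans (A≐P v) (⇔.sym (center≈P v))

  listed⇒isCenterSet : ∀ {A x₁ x₂ y₁ y₂} → x₁ ≢ x₂ → y₁ ≢ y₂ → Listed (A ≐_) → IsCenterSet G A
  listed⇒isCenterSet x₁≢x₂ y₁≢y₂ (inj₁ A≐P) = realizable⇒isCenterSet A≐P (realize-V x₁≢x₂ y₁≢y₂)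
  listed⇒isCenterSet _ y₁≢y₂ (inj₂ (inj₁ A≐P)) = realizable⇒isCenterSet A≐P (realize-inX y₁≢y₂)
  listed⇒isCenterSet x₁≢x₂ _ (inj₂ (inj₂ (inj₁ A≐P))) = realizable⇒isCenterSet A≐P (realize-inY x₁≢x₂)
  listed⇒isCenterSet _ _ (inj₂ (inj₂ (inj₂ (inj₁ (v , A≐P))))) =
    realizable⇒isCenterSet A≐P (realize-point v)
  listed⇒isCenterSet _ _ (inj₂ (inj₂ (inj₂ (inj₂ (x , y , A≐P))))) =
    realizable⇒isCenterSet A≐P (realize-pair x y)

mainTheorem6 : (m n : ℕ) → 1 < m → 1 < n →
    (A : VSet (K m n)) →
    IsCenterSet (K m n) A ⇔
      ( (A ≐ allV)
      ⊎ (A ≐ inX)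
      ⊎ (A ≐ inY)
      ⊎ (∃[ v ] (A ≐ (λ w → w ≡ v)))
      ⊎ (∃[ x ] ∃[ y ] (A ≐ (λ w → (w ≡ inj₁ x) ⊎ (w ≡ inj₂ y)))) )
mainTheorem6 (suc (suc m)) (suc (suc n)) (s≤s (s≤s z≤n)) (s≤s (s≤s z≤n)) A =
  mk⇔ isCenterSet⇒listed
      (listed⇒isCenterSet {x₁ = fzero} {x₂ = fsuc fzero} {y₁ = fzero} {y₂ = fsuc fzero} (λ ()) (λ ()))
  where open CompleteBipartite (suc m) (suc n)
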